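{- Let $1\le k<n$. For every $S\in\Theta(k,2n+1)$, $f_k(S)=(S^{(1)}_i+S^{(2)}_i)_{1\le i\le k}$ lies in $P(n-k,n)$, and $f_k:\Theta(k,2n+1)\to P(n-k,n)$ is injective.
   Context: Type $B_n$ positive roots $e_a\pm e_b$ ($a<b$), $e_a$, ordered by $\alpha\preceq\alpha'$ iff $\alpha'-\alpha$ is a nonnegative combination of the simple roots $e_i-e_{i+1}$ ($i<n$), $e_n$. $\Lambda_k$ = base region $\{e_a\pm e_c,e_a:a\le k<c\}$ $\cup$ top region $\{e_a+e_b:a<b\le k\}$. Row$(a)=\{e_a\pm e_c:c>k\}\cup\{e_a\}$ for $a\le k$. For $S\subseteq\Lambda_k$: $S^{(1)}_i=|S\cap\text{row}(k+1-i)|$, $S^{(2)}_i=|\{a<k+1-i:e_a+e_{k+1-i}\in S\}|$. $\Theta(k,2n+1)$ is the set of $S\subseteq\Lambda_k$ meeting each of the base and top regions in a lower order ideal of that region, such that for every $e_a+e_b$, $a<b\le k$: if $|S\cap\text{row}(a)|+|S\cap\text{row}(b)|>2n+1-2k$ then $e_a+e_b\in S$, and if it is $<2n+1-2k$ then $e_a+e_b\notin S$. $P(n-k,n)$ is the set of partitions with at most $k$ parts, each $\le 2n-k$, which are $(n-k)$-strict: $\gamma_i>\gamma_{i+1}$ whenever $\gamma_i>n-k$. -}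

module Defs where

open import Data.Nat using (ℕ; zero; suc; _+_; _*_; _∸_; _≤_; _<_)
open import Data.Nat.Properties using (_≟_)
open import Data.Integer as ℤ using (ℤ; +_)
open import Data.Bool using (Bool; true; false; T; if_then_else_)
open import Data.Fin using (Fin; toℕ)
open import Data.Vec using (Vec; lookup; tabulate)
open import Data.List using (List; map; upTo; foldr)
open import Data.Product using (Σ; _×_; ∃)
open import Data.Sum using (_⊎_)
open import Relation.Nullary using (¬_)
open import Relation.Nullary.Decidable using (⌊_⌋)
open import Relation.Binary.PropositionalEquality using (_≡_)

sumℕ : List ℕ → ℕ
sumℕ = foldr _+_ 0

sumℤ : List ℤ → ℤ
sumℤ = foldr ℤ._+_ (+ 0)

sumRange : ℕ → ℕ → (ℕ → ℕ) → ℕ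
sumRange lo len f = sumℕ (map (λ j → f (lo + j)) (upTo len))

sumRangeℤ : ℕ → ℕ → (ℕ → ℤ) → ℤ
sumRangeℤ lo len f = sumℤ (map (λ j → f (lo + j)) (upTo len))

-- Roots of type B_n, with 1-based coordinate indices.
--   minus a c = e_a - e_c,  plus a c = e_a + e_c,  short a = e_a

data Root : Set where
  minus : ℕ → ℕ → Root
  plus  : ℕ → ℕ → Root
  short : ℕ → Root

δ : ℕ → ℕ → ℤ
δ i j = if ⌊ i ≟ j ⌋ then + 1 else + 0

vec : Root → ℕ → ℤ
vec (minus a c) j = δ j a ℤ.- δ j c
vec (plus a c)  j = δ j a ℤ.+ δ j c
vec (short a)   j = δ j a

simple : ℕ → ℕ → ℕ → ℤ
simple n i j = if ⌊ i ≟ n ⌋ then δ j n else δ j i ℤ.- δ j (suc i)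

comb : ℕ → (ℕ → ℕ) → ℕ → ℤ
comb n c j = sumRangeℤ 1 n (λ i → (+ c i) ℤ.* simple n i j)

_≼[_]_ : Root → ℕ → Root → Set
α ≼[ n ] α' = Σ (ℕ → ℕ) λ c → ∀ j → 1 ≤ j → j ≤ n → vec α' j ℤ.- vec α j ≡ comb n c j

data InBase (n k : ℕ) : Root → Set where
  base-minus : ∀ {a c} → 1 ≤ a → a ≤ k → k < c → c ≤ n → InBase n k (minus a c)
  base-plus  : ∀ {a c} → 1 ≤ a → a ≤ k → k < c → c ≤ n → InBase n k (plus a c)
  base-short : ∀ {a}   → 1 ≤ a → a ≤ k → InBase n k (short a)

data InTop (k : ℕ) : Root → Set where
  top-plus : ∀ {a b} → 1 ≤ a → a < b → b ≤ k → InTop k (plus a b)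

InΛ : ℕ → ℕ → Root → Set
InΛ n k r = InBase n k r ⊎ InTop k r

Subset : Set
Subset = Root → Bool

bit : Bool → ℕ
bit true = 1
bit false = 0

IsSubsetΛ : ℕ → ℕ → Subset → Set
IsSubsetΛ n k S = ∀ r → T (S r) → InΛ n k r

LowerIdealIn : ℕ → (Root → Set) → Subset → Set
LowerIdealIn n R S = ∀ α β → R α → R β → T (S β) → α ≼[ n ] β → T (S α)

rowCount : ℕ → ℕ → Subset → ℕ → ℕ
rowCount n k S a =
  sumRange (suc k) (n ∸ k) (λ c → bit (S (minus a c)) + bit (S (plus a c)))
  + bit (S (short a))

S1 : ℕ → ℕ → Subset → ℕ → ℕ
S1 n k S i = rowCount n k S (suc k ∸ i)

S2 : ℕ → ℕ → Subset → ℕ → ℕ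
S2 n k S i = sumRange 1 (k ∸ i) (λ a → bit (S (plus a (suc k ∸ i))))

Θ : ℕ → ℕ → Subset → Set
Θ n k S =
  IsSubsetΛ n k S
  × LowerIdealIn n (InBase n k) S
  × LowerIdealIn n (InTop k) S
  × (∀ a b → 1 ≤ a → a < b → b ≤ k →
       (2 * n + 1 ∸ 2 * k < rowCount n k S a + rowCount n k S b → T (S (plus a b)))
     × (rowCount n k S a + rowCount n k S b < 2 * n + 1 ∸ 2 * k → ¬ T (S (plus a b))))

-- f_k(S) = (S^{(1)}_i + S^{(2)}_i)_{1 ≤ i ≤ k}; entry i (Fin k) is index toℕ i + 1
f : (n k : ℕ) → Subset → Vec ℕ k
f n k S = tabulate (λ i → S1 n k S (suc (toℕ i)) + S2 n k S (suc (toℕ i)))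

-- P(n-k, n): partitions with at most k parts (a length-k weakly decreasing
-- vector, padded with zeros), each part ≤ 2n-k, and (n-k)-strict.
P : (n k : ℕ) → Vec ℕ k → Set
P n k γ =
  (∀ (i j : Fin k) → toℕ i ≤ toℕ j → lookup γ j ≤ lookup γ i)
  × (∀ (i : Fin k) → lookup γ i ≤ 2 * n ∸ k)
  × (∀ (i j : Fin k) → toℕ j ≡ suc (toℕ i) → n ∸ k < lookup γ i → lookup γ j < lookup γ i)

module Submission where

-- Write row(a) = |S ∩ row(a)| and col_b(B) = |{a ≤ B : e_a + e_b ∈ S}|.  The
-- entry of f_k(S) with index i is Γ(B) = row(B+1) + col_{B+1}(B), B = k - i,
-- so f_k(S) is the sequence Γ(k-1), …, Γ(0).
--
-- We never decide ≼ in general; we only need sufficient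
--    conditions.  With the potential of a root (the partial sums of its
--    coordinates), β - α is a nonnegative combination of simple roots as soon
--    as the potential of α is pointwise below that of β.  This yields every
--    comparability used later (each row and each column of Λ_k is a chain).
-- 2. f_k(S) ∈ P.  Lower-ideal closure makes rows grow with a and columns grow
--    with b, so Γ is increasing; counting bounds every part by 2n-k; and if
--    Γ(B+1) > n-k but Γ(B) = Γ(B+1), two equal rows above n-k would force
--    their top root by the threshold rule of Θ, giving (n-k)-strictness.
-- 3. Injectivity.  Equal Γ forces equal row sizes, row by row (a smaller row
--    would, by the threshold rule, also give a smaller column).  Then each row
--    and each column is a chain on which S is an ideal, so it is determined by
--    its cardinality.

open import Defs
open import Data.Nat using (ℕ; _≤_; _<_)
open import Data.Product using (_×_)
open import Relation.Binary.PropositionalEquality using (_≡_)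

open import Data.Nat using (zero; suc; z≤n; s≤s; _∸_; _+_; _*_)
import Data.Nat.Properties as ℕP
open import Data.Integer as ℤ using (ℤ; +_; ∣_∣; +≤+)
import Data.Integer.Properties as ℤP
import Data.Integer.Solver as ℤSolver
import Data.Nat.Solver as ℕSolver
open import Data.Bool using (Bool; true; false; T)
open import Data.List using (applyUpTo)
import Data.List.Properties as ListP
open import Data.Fin using (Fin; toℕ; fromℕ<)
import Data.Fin.Properties as FinP
open import Data.Vec using (lookup)
import Data.Vec.Properties as VecP
open import Data.Product using (_,_; proj₁; proj₂)
open import Data.Sum using (_⊎_; inj₁; inj₂)
open import Data.Unit using (tt)
open import Data.Empty using (⊥; ⊥-elim)
open import Relation.Nullary using (¬_; yes; no)
open import Relation.Binary.PropositionalEquality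
  using (refl; sym; trans; cong; cong₂; subst; _≢_; module ≡-Reasoning)
open import Relation.Binary.Definitions using (tri<; tri≈; tri>)
open import Function using (_∘_; id)

bit≤1 : ∀ x → bit x ≤ 1
bit≤1 true  = ℕP.≤-refl
bit≤1 false = z≤n

bit-mono : ∀ {x y : Bool} → (T x → T y) → bit x ≤ bit y
bit-mono {true}  {true}  _ = ℕP.≤-refl
bit-mono {true}  {false} h = ⊥-elim (h tt)
bit-mono {false} _         = z≤n

bit-< : ∀ {x y : Bool} → T x → ¬ T y → bit y < bit x
bit-< {true} {false} _ _  = s≤s z≤n
bit-< {true} {true}  _ ¬y = ⊥-elim (¬y tt)

bool-ext : ∀ {x y : Bool} → (T x → ¬ T y → ⊥) → (T y → ¬ T x → ⊥) → x ≡ y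
bool-ext {false} {false} _ _ = refl
bool-ext {true}  {true}  _ _ = refl
bool-ext {true}  {false} h _ = ⊥-elim (h tt id)
bool-ext {false} {true}  _ h = ⊥-elim (h tt id)

-- SN F len = F 0 + … + F (len - 1), in the form that unfolds under induction on len.
SN : (ℕ → ℕ) → ℕ → ℕ
SN F len = sumℕ (applyUpTo F len)

sumRange-SN : ∀ lo len F → sumRange lo len F ≡ SN (λ j → F (lo + j)) len
sumRange-SN lo len F = cong sumℕ (ListP.map-applyUpTo id (λ j → F (lo + j)) len)

SN-mono : ∀ len (F G : ℕ → ℕ) → (∀ i → i < len → F i ≤ G i) → SN F len ≤ SN G len
SN-mono zero      F G le = z≤n
SN-mono (suc len) F G le =
  ℕP.+-mono-≤ (le 0 (s≤s z≤n)) (SN-mono len (F ∘ suc) (G ∘ suc) (λ i p → le (suc i) (s≤s p)))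

SN-strict : ∀ len (F G : ℕ → ℕ) → (∀ i → i < len → F i ≤ G i) →
            ∀ i₀ → i₀ < len → F i₀ < G i₀ → SN F len < SN G len
SN-strict (suc len) F G le zero _ lt =
  ℕP.+-mono-<-≤ lt (SN-mono len (F ∘ suc) (G ∘ suc) (λ i p → le (suc i) (s≤s p)))
SN-strict (suc len) F G le (suc i₀) (s≤s p) lt =
  ℕP.+-mono-≤-< (le 0 (s≤s z≤n))
    (SN-strict len (F ∘ suc) (G ∘ suc) (λ i q → le (suc i) (s≤s q)) i₀ p lt)

SN-bound : ∀ len (F : ℕ → ℕ) m → (∀ i → F i ≤ m) → SN F len ≤ len * m
SN-bound zero      F m le = z≤n
SN-bound (suc len) F m le = ℕP.+-mono-≤ (le 0) (SN-bound len (F ∘ suc) m (le ∘ suc))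

SN-snoc : ∀ len (F : ℕ → ℕ) → SN F (suc len) ≡ SN F len + F len
SN-snoc zero      F = ℕP.+-comm (F 0) 0
SN-snoc (suc len) F rewrite SN-snoc len (F ∘ suc) = sym (ℕP.+-assoc (F 0) _ _)

sumRange-mono : ∀ lo len (F G : ℕ → ℕ) → (∀ j → lo ≤ j → j < lo + len → F j ≤ G j) →
                sumRange lo len F ≤ sumRange lo len G
sumRange-mono lo len F G le rewrite sumRange-SN lo len F | sumRange-SN lo len G =
  SN-mono len _ _ (λ i p → le (lo + i) (ℕP.m≤m+n lo i) (ℕP.+-monoʳ-< lo p))

sumRange-strict : ∀ lo len (F G : ℕ → ℕ) → (∀ j → lo ≤ j → j < lo + len → F j ≤ G j) →
                  ∀ j → lo ≤ j → j < lo + len → F j < G j → sumRange lo len F < sumRange lo len G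
sumRange-strict lo len F G le j lo≤j j<end lt rewrite sumRange-SN lo len F | sumRange-SN lo len G =
  SN-strict len _ _ (λ i p → le (lo + i) (ℕP.m≤m+n lo i) (ℕP.+-monoʳ-< lo p))
    (j ∸ lo) (ℕP.+-cancelˡ-< lo _ _ (subst (_< lo + len) (sym back) j<end))
    (subst (λ x → F x < G x) (sym back) lt)
  where
  back : lo + (j ∸ lo) ≡ j
  back = ℕP.m+[n∸m]≡n lo≤j

sumRange-bound : ∀ lo len (F : ℕ → ℕ) m → (∀ j → F j ≤ m) → sumRange lo len F ≤ len * m
sumRange-bound lo len F m le rewrite sumRange-SN lo len F = SN-bound len _ m (λ i → le (lo + i))

sumRange-snoc : ∀ lo len F → sumRange lo (suc len) F ≡ sumRange lo len F + F (lo + len)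
sumRange-snoc lo len F rewrite sumRange-SN lo (suc len) F | sumRange-SN lo len F = SN-snoc len _

SZ : (ℕ → ℤ) → ℕ → ℤ
SZ F len = sumℤ (applyUpTo F len)

sumRangeℤ-SZ : ∀ lo len F → sumRangeℤ lo len F ≡ SZ (λ j → F (lo + j)) len
sumRangeℤ-SZ lo len F = cong sumℤ (ListP.map-applyUpTo id (λ j → F (lo + j)) len)

SZ-cong : ∀ len (F G : ℕ → ℤ) → (∀ i → i < len → F i ≡ G i) → SZ F len ≡ SZ G len
SZ-cong zero      F G eq = refl
SZ-cong (suc len) F G eq =
  cong₂ ℤ._+_ (eq 0 (s≤s z≤n)) (SZ-cong len (F ∘ suc) (G ∘ suc) (λ i p → eq (suc i) (s≤s p)))

SZ-zero : ∀ len (F : ℕ → ℤ) → (∀ i → i < len → F i ≡ + 0) → SZ F len ≡ + 0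
SZ-zero len F eq = trans (SZ-cong len F (λ _ → + 0) eq) (zeros len)
  where
  zeros : ∀ len → SZ (λ _ → + 0) len ≡ + 0
  zeros zero      = refl
  zeros (suc len) = trans (ℤP.+-identityˡ _) (zeros len)

SZ-single : ∀ len (F : ℕ → ℤ) i₀ → i₀ < len →
            (∀ i → i < len → i ≢ i₀ → F i ≡ + 0) → SZ F len ≡ F i₀
SZ-single (suc len) F zero _ eq
  rewrite SZ-zero len (F ∘ suc) (λ i q → eq (suc i) (s≤s q) (λ ())) = ℤP.+-identityʳ (F 0)
SZ-single (suc len) F (suc i₀) (s≤s p) eq rewrite eq 0 (s≤s z≤n) (λ ()) =
  trans (ℤP.+-identityˡ _)
    (SZ-single len (F ∘ suc) i₀ p (λ i q i≢ → eq (suc i) (s≤s q) (i≢ ∘ ℕP.suc-injective)))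

SZ-sub : ∀ len (F G : ℕ → ℤ) → SZ (λ i → F i ℤ.- G i) len ≡ SZ F len ℤ.- SZ G len
SZ-sub zero      F G = refl
SZ-sub (suc len) F G rewrite SZ-sub len (F ∘ suc) (G ∘ suc) =
  solve 4 (λ a b c d → (a :- b) :+ (c :- d) := (a :+ c) :- (b :+ d)) refl
    (F 0) (G 0) (SZ (F ∘ suc) len) (SZ (G ∘ suc) len)
  where open ℤSolver.+-*-Solver

δ-refl : ∀ j → δ j j ≡ + 1
δ-refl j with j ℕP.≟ j
... | yes _  = refl
... | no j≢j = ⊥-elim (j≢j refl)

δ-neq : ∀ j x → j ≢ x → δ j x ≡ + 0
δ-neq j x j≢x with j ℕP.≟ x
... | yes j≡x = ⊥-elim (j≢x j≡x)
... | no _    = refl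

SZ-pick : ∀ len (g : ℕ → ℤ) s x → x < len → SZ (λ i → g i ℤ.* δ (s + x) (s + i)) len ≡ g x
SZ-pick len g s x x<len = trans (SZ-single len _ x x<len off) on
  where
  off : ∀ i → i < len → i ≢ x → g i ℤ.* δ (s + x) (s + i) ≡ + 0
  off i _ i≢x = trans (cong (g i ℤ.*_) (δ-neq _ _ (λ e → i≢x (sym (ℕP.+-cancelˡ-≡ s x i e)))))
                      (ℤP.*-zeroʳ (g i))
  on : g x ℤ.* δ (s + x) (s + x) ≡ g x
  on = trans (cong (g x ℤ.*_) (δ-refl (s + x))) (ℤP.*-identityʳ (g x))

-- Inside the ambient coordinates, every simple root is e_i - e_{i+1}
-- (for i = n the coordinate n+1 does not exist).
simple-eq : ∀ n i j → j ≤ n → simple n i j ≡ δ j i ℤ.- δ j (suc i)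
simple-eq n i j j≤n with i ℕP.≟ n
... | yes refl rewrite δ-neq j (suc n) (λ e → ℕP.<-irrefl e (s≤s j≤n)) = sym (ℤP.+-identityʳ _)
... | no _     = refl

comb-eq : ∀ n (c : ℕ → ℕ) → c 0 ≡ 0 → ∀ j → 1 ≤ j → j ≤ n → comb n c j ≡ + c j ℤ.- + c (j ∸ 1)
comb-eq n c c₀ (suc j) _ j<n = begin
    comb n c (suc j)
  ≡⟨ sumRangeℤ-SZ 1 n (λ i → + c i ℤ.* simple n i (suc j)) ⟩
    SZ (λ i → + c (suc i) ℤ.* simple n (suc i) (suc j)) n
  ≡⟨ SZ-cong n _ _ (λ i _ → trans (cong (+ c (suc i) ℤ.*_) (simple-eq n (suc i) (suc j) j<n))
                                  (distrib (+ c (suc i)) _ _)) ⟩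
    SZ (λ i → + c (suc i) ℤ.* δ (suc j) (suc i) ℤ.- + c (suc i) ℤ.* δ (suc j) (suc (suc i))) n
  ≡⟨ SZ-sub n _ _ ⟩
    SZ (λ i → + c (suc i) ℤ.* δ (suc j) (suc i)) n
      ℤ.- SZ (λ i → + c (suc i) ℤ.* δ (suc j) (suc (suc i))) n
  ≡⟨ cong₂ ℤ._-_ (SZ-pick n (λ i → + c (suc i)) 1 j j<n) (previous j j<n) ⟩
    + c (suc j) ℤ.- + c j
  ∎
  where
  open ≡-Reasoning
  distrib : ∀ a b d → a ℤ.* (b ℤ.- d) ≡ a ℤ.* b ℤ.- a ℤ.* d
  distrib = solve 3 (λ a b d → a :* (b :- d) := a :* b :- a :* d) refl
    where open ℤSolver.+-*-Solver
  previous : ∀ j → suc j ≤ n → SZ (λ i → + c (suc i) ℤ.* δ (suc j) (suc (suc i))) n ≡ + c j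
  previous zero _ = trans (SZ-zero n _ vanish) (cong +_ (sym c₀))
    where
    vanish : ∀ i → i < n → + c (suc i) ℤ.* δ 1 (suc (suc i)) ≡ + 0
    vanish i _ = trans (cong (+ c (suc i) ℤ.*_) (δ-neq 1 (suc (suc i)) (λ ()))) (ℤP.*-zeroʳ (+ c (suc i)))
  previous (suc j) sj<n = SZ-pick n (λ i → + c (suc i)) 2 j (ℕP.<-trans (ℕP.n<1+n j) sj<n)

ind : ℕ → ℕ → ℕ
ind zero    j       = 1
ind (suc x) zero    = 0
ind (suc x) (suc j) = ind x j

ind-le : ∀ x j → x ≤ j → ind x j ≡ 1
ind-le zero    j       _       = refl
ind-le (suc x) (suc j) (s≤s p) = ind-le x j p

ind-gt : ∀ x j → j < x → ind x j ≡ 0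
ind-gt (suc x) zero    _       = refl
ind-gt (suc x) (suc j) (s≤s p) = ind-gt x j p

ind≤1 : ∀ x j → ind x j ≤ 1
ind≤1 zero    j       = ℕP.≤-refl
ind≤1 (suc x) zero    = z≤n
ind≤1 (suc x) (suc j) = ind≤1 x j

ind-antitone : ∀ {x y} j → x ≤ y → ind y j ≤ ind x j
ind-antitone {zero}  {zero}  j       _       = ℕP.≤-refl
ind-antitone {zero}  {suc y} j       _       = ind≤1 (suc y) j
ind-antitone {suc x} {suc y} zero    _       = z≤n
ind-antitone {suc x} {suc y} (suc j) (s≤s p) = ind-antitone j p

δ-ind : ∀ x j → δ (suc j) x ≡ + ind x (suc j) ℤ.- + ind x j
δ-ind x j with ℕP.<-cmp x (suc j)
... | tri< (s≤s x≤j) x≢ _ rewrite ind-le x (suc j) (ℕP.m≤n⇒m≤1+n x≤j) | ind-le x j x≤j =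
  δ-neq (suc j) x (x≢ ∘ sym)
... | tri≈ _ refl _ rewrite ind-le (suc j) (suc j) ℕP.≤-refl | ind-gt (suc j) j ℕP.≤-refl =
  δ-refl (suc j)
... | tri> _ x≢ j<x rewrite ind-gt x (suc j) j<x | ind-gt x j (ℕP.<-trans (ℕP.n<1+n j) j<x) =
  δ-neq (suc j) x (x≢ ∘ sym)

-- pot α j = Σ_{i ≤ j} (coordinate i of α).
pot : Root → ℕ → ℤ
pot (minus a c) j = + ind a j ℤ.- + ind c j
pot (plus a c)  j = + ind a j ℤ.+ + ind c j
pot (short a)   j = + ind a j

vec-pot : ∀ r j → vec r (suc j) ≡ pot r (suc j) ℤ.- pot r j
vec-pot (minus a c) j rewrite δ-ind a j | δ-ind c j =
  solve 4 (λ A A' C C' → (A :- A') :- (C :- C') := (A :- C) :- (A' :- C')) refl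
    (+ ind a (suc j)) (+ ind a j) (+ ind c (suc j)) (+ ind c j)
  where open ℤSolver.+-*-Solver
vec-pot (plus a c) j rewrite δ-ind a j | δ-ind c j =
  solve 4 (λ A A' C C' → (A :- A') :+ (C :- C') := (A :+ C) :- (A' :+ C')) refl
    (+ ind a (suc j)) (+ ind a j) (+ ind c (suc j)) (+ ind c j)
  where open ℤSolver.+-*-Solver
vec-pot (short a) j = δ-ind a j

-- Dominance criterion: if the potentials of α lie pointwise below those of β
-- (with equal value at 0), then α ≼ β, the coefficient of α_j in β - α being
-- the gap pot β j - pot α j.
≼-by-potential : ∀ {n} α β → pot α 0 ≡ pot β 0 → (∀ j → pot α j ℤ.≤ pot β j) → α ≼[ n ] β
≼-by-potential {n} α β same₀ below = coeff , coords
  where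
  coeff : ℕ → ℕ
  coeff j = ∣ pot β j ℤ.- pot α j ∣
  coeff≡ : ∀ j → + coeff j ≡ pot β j ℤ.- pot α j
  coeff≡ j = ℤP.0≤i⇒+∣i∣≡i (ℤP.i≤j⇒0≤j-i (below j))
  coeff₀ : coeff 0 ≡ 0
  coeff₀ = cong ∣_∣ (trans (cong (ℤ._- pot α 0) (sym same₀)) (ℤP.+-inverseʳ (pot α 0)))
  coords : ∀ j → 1 ≤ j → j ≤ n → vec β j ℤ.- vec α j ≡ comb n coeff j
  coords (suc j) _ j<n
    rewrite comb-eq n coeff coeff₀ (suc j) (s≤s z≤n) j<n | coeff≡ (suc j) | coeff≡ j
          | vec-pot β j | vec-pot α j =
    solve 4 (λ B B' A A' → (B :- B') :- (A :- A') := (B :- A) :- (B' :- A')) refl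
      (pot β (suc j)) (pot β j) (pot α (suc j)) (pot α j)
    where open ℤSolver.+-*-Solver

private
  H : ℕ → ℕ → ℤ
  H x j = + ind x j

  H-antitone : ∀ {x y} j → x ≤ y → H y j ℤ.≤ H x j
  H-antitone j x≤y = +≤+ (ind-antitone j x≤y)

  minus≤ : ∀ a b → a ℤ.- + b ℤ.≤ a
  minus≤ a b = ℤP.i≤j⇒i-k≤j (+ b) ℤP.≤-refl

≼-refl : ∀ {n} r → r ≼[ n ] r
≼-refl r = ≼-by-potential r r refl (λ _ → ℤP.≤-refl)

minus≼minus : ∀ {n a a' c c'} → 1 ≤ a → 1 ≤ a' → 1 ≤ c → 1 ≤ c' → a ≤ a' → c ≤ c' →
              minus a' c ≼[ n ] minus a c'
minus≼minus {a = a} {a'} {c} {c'} (s≤s z≤n) (s≤s z≤n) (s≤s z≤n) (s≤s z≤n) a≤a' c≤c' =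
  ≼-by-potential (minus a' c) (minus a c') refl
    (λ j → ℤP.+-mono-≤ (H-antitone j a≤a') (ℤP.neg-mono-≤ (H-antitone j c≤c')))

minus≼short : ∀ {n a c} → 1 ≤ a → 1 ≤ c → minus a c ≼[ n ] short a
minus≼short {a = a} {c} (s≤s z≤n) (s≤s z≤n) =
  ≼-by-potential (minus a c) (short a) refl (λ j → minus≤ (H a j) (ind c j))

minus≼plus : ∀ {n a c c'} → 1 ≤ a → 1 ≤ c → 1 ≤ c' → minus a c ≼[ n ] plus a c'
minus≼plus {a = a} {c} {c'} (s≤s z≤n) (s≤s z≤n) (s≤s z≤n) =
  ≼-by-potential (minus a c) (plus a c') refl
    (λ j → ℤP.≤-trans (minus≤ (H a j) (ind c j)) (ℤP.i≤i+j (H a j) (H c' j)))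

short≼plus : ∀ {n a c} → 1 ≤ a → 1 ≤ c → short a ≼[ n ] plus a c
short≼plus {a = a} {c} (s≤s z≤n) (s≤s z≤n) =
  ≼-by-potential (short a) (plus a c) refl (λ j → ℤP.i≤i+j (H a j) (H c j))

plus≼plus : ∀ {n a a' b b'} → 1 ≤ a → 1 ≤ a' → 1 ≤ b → 1 ≤ b' → a ≤ a' → b ≤ b' →
            plus a' b' ≼[ n ] plus a b
plus≼plus {a = a} {a'} {b} {b'} (s≤s z≤n) (s≤s z≤n) (s≤s z≤n) (s≤s z≤n) a≤a' b≤b' =
  ≼-by-potential (plus a' b') (plus a b) refl
    (λ j → ℤP.+-mono-≤ (H-antitone j a≤a') (H-antitone j b≤b'))

short≼short : ∀ {n a a'} → 1 ≤ a → 1 ≤ a' → a ≤ a' → short a' ≼[ n ] short a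
short≼short {a = a} {a'} (s≤s z≤n) (s≤s z≤n) a≤a' =
  ≼-by-potential (short a') (short a) refl (λ j → H-antitone j a≤a')

ideal-bit : ∀ {n R S α β} → LowerIdealIn n R S → R α → R β → α ≼[ n ] β → bit (S β) ≤ bit (S α)
ideal-bit ideal Rα Rβ α≼β = bit-mono (λ β∈S → ideal _ _ Rα Rβ β∈S α≼β)

chain-dominance : ∀ {n R} {S S' : Subset} → LowerIdealIn n R S → LowerIdealIn n R S' →
                  ∀ {y z} → R y → R z → (z ≼[ n ] y) ⊎ (y ≼[ n ] z) →
                  T (S y) → ¬ T (S' y) → bit (S' z) ≤ bit (S z)
chain-dominance ideal ideal' Ry Rz (inj₁ z≼y) y∈S _ = bit-mono (λ _ → ideal _ _ Rz Ry y∈S z≼y)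
chain-dominance ideal ideal' Ry Rz (inj₂ y≼z) _ y∉S' =
  bit-mono (λ z∈S' → ⊥-elim (y∉S' (ideal' _ _ Ry Rz z∈S' y≼z)))

-- Arithmetic of the indices: entry i of f_k(S) (0-based) belongs to row k - i.

∸-suc : ∀ k m → m < k → k ∸ m ≡ suc (k ∸ suc m)
∸-suc (suc k) zero    _       = refl
∸-suc (suc k) (suc m) (s≤s p) = ∸-suc k m p

∸-suc-involutive : ∀ k B → B < k → k ∸ suc (k ∸ suc B) ≡ B
∸-suc-involutive (suc k) B (s≤s p) = ℕP.m∸[m∸n]≡n p

∸-suc-< : ∀ k m → m < k → k ∸ suc m < k
∸-suc-< k m m<k = ℕP.∸-monoʳ-< {k} {suc m} {0} (s≤s z≤n) m<k

threshold≡ : ∀ n k → k ≤ n → 2 * n + 1 ∸ 2 * k ≡ suc (2 * (n ∸ k))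
threshold≡ n k k≤n = begin
    2 * n + 1 ∸ 2 * k  ≡⟨ ℕP.+-∸-comm 1 (ℕP.*-monoʳ-≤ 2 k≤n) ⟩
    2 * n ∸ 2 * k + 1  ≡⟨ cong (_+ 1) (sym (ℕP.*-distribˡ-∸ 2 n k)) ⟩
    2 * (n ∸ k) + 1    ≡⟨ ℕP.+-comm _ 1 ⟩
    suc (2 * (n ∸ k))  ∎
  where open ≡-Reasoning

-- A row has at most 2(n-k)+1 elements and a column at most k-1, in total 2n-k.
part-bound≡ : ∀ n k → 1 ≤ k → k ≤ n → (n ∸ k) * 2 + 1 + (k ∸ 1) ≡ 2 * n ∸ k
part-bound≡ n (suc k) _ k<n = begin
    d * 2 + 1 + k                      ≡⟨ sym (ℕP.m+n∸m≡n (suc k) _) ⟩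
    suc k + (d * 2 + 1 + k) ∸ suc k     ≡⟨ cong (_∸ suc k) (regroup k d) ⟩
    2 * (suc k + d) ∸ suc k             ≡⟨ cong (λ x → 2 * x ∸ suc k) (ℕP.m+[n∸m]≡n k<n) ⟩
    2 * n ∸ suc k                       ∎
  where
  open ≡-Reasoning
  d = n ∸ suc k
  regroup : ∀ k d → suc k + (d * 2 + 1 + k) ≡ 2 * (suc k + d)
  regroup = solve 2 (λ k d → (con 1 :+ k) :+ (d :* con 2 :+ con 1 :+ k) := con 2 :* ((con 1 :+ k) :+ d)) refl
    where open ℕSolver.+-*-Solver

-- Two rows of size > d together have more than 2d+1 roots.
double-suc : ∀ d → suc (suc (2 * d)) ≡ suc d + suc d
double-suc = solve 1 (λ d → con 2 :+ con 2 :* d := (con 1 :+ d) :+ (con 1 :+ d)) refl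
  where open ℕSolver.+-*-Solver

stepwise-mono : ∀ (g : ℕ → ℕ) k → (∀ B → suc B < k → g B ≤ g (suc B)) →
                ∀ {B B'} → B ≤ B' → B' < k → g B ≤ g B'
stepwise-mono g k step {B} {zero}   z≤n _ = ℕP.≤-refl
stepwise-mono g k step {B} {suc B'} B≤ B'<k with ℕP.m≤n⇒m<n∨m≡n B≤
... | inj₁ (s≤s B≤B') =
  ℕP.≤-trans (stepwise-mono g k step B≤B' (ℕP.<-trans (ℕP.n<1+n B') B'<k)) (step B' B'<k)
... | inj₂ refl       = ℕP.≤-refl

module ThetaFacts (n k : ℕ) (1≤k : 1 ≤ k) (k<n : k < n) where

  k≤n : k ≤ n
  k≤n = ℕP.<⇒≤ k<n

  threshold : ℕ
  threshold = 2 * n + 1 ∸ 2 * k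

  row : Subset → ℕ → ℕ
  row S a = rowCount n k S a

  col : Subset → ℕ → ℕ → ℕ
  col S B b = sumRange 1 B (λ a → bit (S (plus a b)))

  Γ : Subset → ℕ → ℕ
  Γ S B = row S (suc B) + col S B (suc B)

  base-ideal : ∀ {S} → Θ n k S → LowerIdealIn n (InBase n k) S
  base-ideal th = proj₁ (proj₂ th)

  top-ideal : ∀ {S} → Θ n k S → LowerIdealIn n (InTop k) S
  top-ideal th = proj₁ (proj₂ (proj₂ th))

  forced : ∀ {S} → Θ n k S → ∀ a b → 1 ≤ a → a < b → b ≤ k →
           threshold < row S a + row S b → T (S (plus a b))
  forced th a b 1≤a a<b b≤k = proj₁ (proj₂ (proj₂ (proj₂ th)) a b 1≤a a<b b≤k)

  forbidden : ∀ {S} → Θ n k S → ∀ a b → 1 ≤ a → a < b → b ≤ k →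
              row S a + row S b < threshold → ¬ T (S (plus a b))
  forbidden th a b 1≤a a<b b≤k = proj₂ (proj₂ (proj₂ (proj₂ th)) a b 1≤a a<b b≤k)

  pos : ∀ {c} → k < c → 1 ≤ c
  pos k<c = ℕP.≤-trans (s≤s z≤n) k<c

  in-row-range : ∀ {c} → c ≤ n → c < suc k + (n ∸ k)
  in-row-range {c} c≤n = s≤s (subst (c ≤_) (sym (ℕP.m+[n∸m]≡n k≤n)) c≤n)

  from-row-range : ∀ {c} → c < suc k + (n ∸ k) → c ≤ n
  from-row-range {c} c< = subst (c ≤_) (ℕP.m+[n∸m]≡n k≤n) (ℕP.≤-pred c<)

  -- Rows grow downwards: e_a ± e_c ∈ S ⇒ e_{a+1} ± e_c ∈ S, and e_a ∈ S ⇒ e_{a+1} ∈ S.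
  row-mono : ∀ {S} → Θ n k S → ∀ a → 1 ≤ a → suc a ≤ k → row S a ≤ row S (suc a)
  row-mono {S} th a 1≤a sa≤k = ℕP.+-mono-≤ (sumRange-mono (suc k) (n ∸ k) _ _ pair) short-step
    where
    a≤k = ℕP.<⇒≤ sa≤k
    1≤sa : 1 ≤ suc a
    1≤sa = s≤s z≤n
    pair : ∀ c → suc k ≤ c → c < suc k + (n ∸ k) →
           bit (S (minus a c)) + bit (S (plus a c)) ≤ bit (S (minus (suc a) c)) + bit (S (plus (suc a) c))
    pair c k<c c< = ℕP.+-mono-≤
      (ideal-bit (base-ideal th) (base-minus 1≤sa sa≤k k<c c≤n) (base-minus 1≤a a≤k k<c c≤n)
        (minus≼minus 1≤a 1≤sa (pos k<c) (pos k<c) (ℕP.n≤1+n a) ℕP.≤-refl))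
      (ideal-bit (base-ideal th) (base-plus 1≤sa sa≤k k<c c≤n) (base-plus 1≤a a≤k k<c c≤n)
        (plus≼plus 1≤a 1≤sa (pos k<c) (pos k<c) (ℕP.n≤1+n a) ℕP.≤-refl))
      where c≤n = from-row-range c<
    short-step : bit (S (short a)) ≤ bit (S (short (suc a)))
    short-step = ideal-bit (base-ideal th) (base-short 1≤sa sa≤k) (base-short 1≤a a≤k)
                   (short≼short 1≤a 1≤sa (ℕP.n≤1+n a))

  -- Columns grow to the right: e_a + e_b ∈ S ⇒ e_a + e_{b+1} ∈ S.
  col-mono : ∀ {S} → Θ n k S → ∀ B b → B < b → suc b ≤ k → col S B b ≤ col S B (suc b)
  col-mono {S} th B b B<b sb≤k = sumRange-mono 1 B _ _ entry
    where
    entry : ∀ a → 1 ≤ a → a < 1 + B → bit (S (plus a b)) ≤ bit (S (plus a (suc b)))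
    entry a 1≤a (s≤s a≤B) =
      ideal-bit (top-ideal th) (top-plus 1≤a (ℕP.<-trans a<b (ℕP.n<1+n b)) sb≤k)
                               (top-plus 1≤a a<b (ℕP.<⇒≤ sb≤k))
        (plus≼plus 1≤a 1≤a 1≤b (ℕP.m≤n⇒m≤1+n 1≤b) ℕP.≤-refl (ℕP.n≤1+n b))
      where
      a<b = ℕP.≤-<-trans a≤B B<b
      1≤b = ℕP.≤-trans 1≤a (ℕP.<⇒≤ a<b)

  col-suc : ∀ S B b → col S (suc B) b ≡ col S B b + bit (S (plus (suc B) b))
  col-suc S B b = sumRange-snoc 1 B (λ a → bit (S (plus a b)))

  Γ-below-off-diagonal : ∀ {S} → Θ n k S → ∀ B → suc B < k →
                         Γ S B ≤ row S (2 + B) + col S B (2 + B)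
  Γ-below-off-diagonal th B sB<k =
    ℕP.+-mono-≤ (row-mono th (suc B) (s≤s z≤n) sB<k) (col-mono th B (suc B) ℕP.≤-refl sB<k)

  -- Γ is weakly increasing, i.e. f_k(S) is weakly decreasing.
  Γ-step : ∀ {S} → Θ n k S → ∀ B → suc B < k → Γ S B ≤ Γ S (suc B)
  Γ-step {S} th B sB<k = begin
      Γ S B                                    ≤⟨ Γ-below-off-diagonal th B sB<k ⟩
      row S (2 + B) + col S B (2 + B)          ≤⟨ ℕP.+-monoʳ-≤ (row S (2 + B)) (ℕP.m≤m+n _ _) ⟩
      row S (2 + B) + (col S B (2 + B) + _)    ≡⟨ cong (_+_ (row S (2 + B))) (sym (col-suc S B (2 + B))) ⟩
      Γ S (suc B)                              ∎
    where open ℕP.≤-Reasoning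

  -- Rows a < b of equal size exceeding n-k force e_a + e_b ∈ S: their sum exceeds 2(n-k)+1.
  equal-large-rows-force : ∀ {S} → Θ n k S → ∀ a b → 1 ≤ a → a < b → b ≤ k →
                           row S a ≡ row S b → n ∸ k < row S b → T (S (plus a b))
  equal-large-rows-force {S} th a b 1≤a a<b b≤k same large = forced th a b 1≤a a<b b≤k exceeds
    where
    open ℕP.≤-Reasoning
    exceeds : threshold < row S a + row S b
    exceeds = begin-strict
      threshold                  ≡⟨ threshold≡ n k k≤n ⟩
      suc (2 * (n ∸ k))          <⟨ ℕP.n<1+n _ ⟩
      suc (suc (2 * (n ∸ k)))    ≡⟨ double-suc (n ∸ k) ⟩
      suc (n ∸ k) + suc (n ∸ k)  ≤⟨ ℕP.+-mono-≤ (subst (n ∸ k <_) (sym same) large) large ⟩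
      row S a + row S b          ∎

  col-empty : ∀ {S} → Θ n k S → ∀ B → suc B < k →
              ¬ T (S (plus (suc B) (2 + B))) → col S B (2 + B) ≡ 0
  col-empty {S} th B sB<k diag∉S = ℕP.n≤0⇒n≡0 (begin
      col S B (2 + B)              ≤⟨ sumRange-mono 1 B _ _ absent ⟩
      sumRange 1 B (λ _ → 0)       ≤⟨ sumRange-bound 1 B _ 0 (λ _ → z≤n) ⟩
      B * 0                        ≡⟨ ℕP.*-zeroʳ B ⟩
      0                            ∎)
    where
    open ℕP.≤-Reasoning
    absent : ∀ a → 1 ≤ a → a < 1 + B → bit (S (plus a (2 + B))) ≤ 0
    absent a 1≤a (s≤s a≤B) = bit-mono {y = false} (λ a∈S → diag∉S (top-ideal th _ _
      (top-plus (s≤s z≤n) ℕP.≤-refl sB<k) (top-plus 1≤a (s≤s (ℕP.m≤n⇒m≤1+n a≤B)) sB<k) a∈S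
      (plus≼plus 1≤a (s≤s z≤n) (s≤s z≤n) (s≤s z≤n) (ℕP.m≤n⇒m≤1+n a≤B) ℕP.≤-refl)))

  Γ-strict : ∀ {S} → Θ n k S → ∀ B → suc B < k → n ∸ k < Γ S (suc B) → Γ S B < Γ S (suc B)
  Γ-strict {S} th B sB<k large =
    subst (Γ S B <_) (sym (cong (_+_ (row S b₁)) (col-suc S B b₁))) (by-diagonal (S (plus b b₁)) refl)
    where
    b = suc B
    b₁ = suc b
    by-diagonal : ∀ x → S (plus b b₁) ≡ x → Γ S B < row S b₁ + (col S B b₁ + bit x)
    by-diagonal true _ =
      ℕP.≤-<-trans (Γ-below-off-diagonal th B sB<k) (ℕP.+-monoʳ-< (row S b₁) (ℕP.m<m+n _ (s≤s z≤n)))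
    by-diagonal false diag≡ = begin-strict
        row S b + col S B b          ≡⟨ cong (_+_ (row S b)) col₀≡0 ⟩
        row S b + 0                  ≡⟨ ℕP.+-identityʳ _ ⟩
        row S b                      <⟨ rows< ⟩
        row S b₁                     ≡⟨ sym on-row ⟩
        row S b₁ + (col S B b₁ + 0)  ∎
      where
      open ℕP.≤-Reasoning
      diag∉S : ¬ T (S (plus b b₁))
      diag∉S = subst T diag≡
      col₁≡0 : col S B b₁ ≡ 0
      col₁≡0 = col-empty th B sB<k diag∉S
      col₀≡0 : col S B b ≡ 0
      col₀≡0 = ℕP.n≤0⇒n≡0 (ℕP.≤-trans (col-mono th B b ℕP.≤-refl sB<k) (ℕP.≤-reflexive col₁≡0))
      on-row : row S b₁ + (col S B b₁ + 0) ≡ row S b₁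
      on-row = trans (cong (λ m → row S b₁ + (m + 0)) col₁≡0) (ℕP.+-identityʳ _)
      Γ-next≡row : Γ S (suc B) ≡ row S b₁
      Γ-next≡row = trans (cong (_+_ (row S b₁)) (col-suc S B b₁))
                         (trans (cong (λ x → row S b₁ + (col S B b₁ + bit x)) diag≡) on-row)
      rows< : row S b < row S b₁
      rows< with ℕP.m≤n⇒m<n∨m≡n (row-mono th b (s≤s z≤n) sB<k)
      ... | inj₁ lt   = lt
      ... | inj₂ same = ⊥-elim (diag∉S (equal-large-rows-force th b b₁ (s≤s z≤n) ℕP.≤-refl sB<k same
                                          (subst (n ∸ k <_) Γ-next≡row large)))

  row-bound : ∀ S a → row S a ≤ (n ∸ k) * 2 + 1
  row-bound S a = ℕP.+-mono-≤
    (sumRange-bound (suc k) (n ∸ k) _ 2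
      (λ c → ℕP.+-mono-≤ (bit≤1 (S (minus a c))) (bit≤1 (S (plus a c)))))
    (bit≤1 (S (short a)))

  col-bound : ∀ S B b → col S B b ≤ B
  col-bound S B b = ℕP.≤-trans (sumRange-bound 1 B _ 1 (λ a → bit≤1 (S (plus a b))))
                               (ℕP.≤-reflexive (ℕP.*-identityʳ B))

  entry : ∀ S (i : Fin k) → lookup (f n k S) i ≡ Γ S (k ∸ suc (toℕ i))
  entry S i = trans (VecP.lookup∘tabulate _ i)
    (cong (λ b → rowCount n k S b + sumRange 1 (k ∸ suc (toℕ i)) (λ a → bit (S (plus a b))))
      (∸-suc k (toℕ i) (FinP.toℕ<n i)))

  f-in-P : ∀ S → Θ n k S → P n k (f n k S)
  f-in-P S th = decreasing , bounded , strict
    where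
    decreasing : ∀ (i j : Fin k) → toℕ i ≤ toℕ j → lookup (f n k S) j ≤ lookup (f n k S) i
    decreasing i j i≤j rewrite entry S i | entry S j =
      stepwise-mono (Γ S) k (Γ-step th) (ℕP.∸-monoʳ-≤ k (s≤s i≤j)) (∸-suc-< k (toℕ i) (FinP.toℕ<n i))
    bounded : ∀ (i : Fin k) → lookup (f n k S) i ≤ 2 * n ∸ k
    bounded i rewrite entry S i = ℕP.≤-trans
      (ℕP.+-mono-≤ (row-bound S _) (ℕP.≤-trans (col-bound S B _) (ℕP.∸-monoʳ-≤ k (s≤s z≤n))))
      (ℕP.≤-reflexive (part-bound≡ n k 1≤k k≤n))
      where B = k ∸ suc (toℕ i)
    strict : ∀ (i j : Fin k) → toℕ j ≡ suc (toℕ i) → n ∸ k < lookup (f n k S) i →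
             lookup (f n k S) j < lookup (f n k S) i
    strict i j j≡ large rewrite entry S i | entry S j =
      subst (λ x → Γ S B < Γ S x) (sym i↦) (Γ-strict th B sB<k (subst (λ x → n ∸ k < Γ S x) i↦ large))
      where
      B = k ∸ suc (toℕ j)
      i↦ : k ∸ suc (toℕ i) ≡ suc B
      i↦ = trans (cong (k ∸_) (sym j≡)) (∸-suc k (toℕ j) (FinP.toℕ<n j))
      sB<k : suc B < k
      sB<k = subst (_< k) i↦ (∸-suc-< k (toℕ i) (FinP.toℕ<n i))

  Γ-from-f : ∀ S S' → f n k S ≡ f n k S' → ∀ B → B < k → Γ S B ≡ Γ S' B
  Γ-from-f S S' same B B<k = subst (λ x → Γ S x ≡ Γ S' x) i↦B
    (trans (sym (entry S i)) (trans (cong (λ v → lookup v i) same) (entry S' i)))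
    where
    i : Fin k
    i = fromℕ< (∸-suc-< k B B<k)
    i↦B : k ∸ suc (toℕ i) ≡ B
    i↦B = trans (cong (λ x → k ∸ suc x) (FinP.toℕ-fromℕ< (∸-suc-< k B B<k))) (∸-suc-involutive k B B<k)

  RowsAgreeUpTo : Subset → Subset → ℕ → Set
  RowsAgreeUpTo S S' B = ∀ a → 1 ≤ a → a ≤ B → row S a ≡ row S' a

  -- If rows 1..B agree and row B+1 of S is smaller, the threshold rule shrinks
  -- column B+1 as well, so Γ_S(B) < Γ_S'(B).
  row-gap⇒Γ-gap : ∀ {S S'} → Θ n k S → Θ n k S' → ∀ B → suc B ≤ k → RowsAgreeUpTo S S' B →
                  row S (suc B) < row S' (suc B) → Γ S B < Γ S' B
  row-gap⇒Γ-gap {S} {S'} th th' B sB≤k agree row< = ℕP.+-mono-<-≤ row< (sumRange-mono 1 B _ _ column)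
    where
    b = suc B
    column : ∀ a → 1 ≤ a → a < 1 + B → bit (S (plus a b)) ≤ bit (S' (plus a b))
    column a 1≤a (s≤s a≤B) = bit-mono (λ a∈S → forced th' a b 1≤a (s≤s a≤B) sB≤k
      (subst (λ x → threshold < x + row S' b) (agree a 1≤a a≤B)
        (ℕP.≤-<-trans (ℕP.≮⇒≥ (λ below → forbidden th a b 1≤a (s≤s a≤B) sB≤k below a∈S))
                      (ℕP.+-monoʳ-< (row S a) row<))))

  rows-agree : ∀ {S S'} → Θ n k S → Θ n k S' → (∀ B → B < k → Γ S B ≡ Γ S' B) →
               ∀ B → B ≤ k → RowsAgreeUpTo S S' B
  rows-agree th th' sameΓ zero _ a (s≤s z≤n) ()
  rows-agree {S} {S'} th th' sameΓ (suc B) sB≤k = extend (rows-agree th th' sameΓ B (ℕP.<⇒≤ sB≤k))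
    where
    extend : RowsAgreeUpTo S S' B → RowsAgreeUpTo S S' (suc B)
    extend before a 1≤a a≤sB with ℕP.m≤n⇒m<n∨m≡n a≤sB
    ... | inj₁ (s≤s a≤B) = before a 1≤a a≤B
    ... | inj₂ refl with ℕP.<-cmp (row S (suc B)) (row S' (suc B))
    ...   | tri≈ _ same _ = same
    ...   | tri< lt _ _ = ⊥-elim (ℕP.<-irrefl (sameΓ B sB≤k) (row-gap⇒Γ-gap th th' B sB≤k before lt))
    ...   | tri> _ _ gt = ⊥-elim (ℕP.<-irrefl (sym (sameΓ B sB≤k))
              (row-gap⇒Γ-gap th' th B sB≤k (λ a' 1≤a' a'≤B → sym (before a' 1≤a' a'≤B)) gt))

  data InRow (b : ℕ) : Root → Set where
    row-minus : ∀ {c} → k < c → c ≤ n → InRow b (minus b c)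
    row-plus  : ∀ {c} → k < c → c ≤ n → InRow b (plus b c)
    row-short : InRow b (short b)

  row-in-base : ∀ {b y} → 1 ≤ b → b ≤ k → InRow b y → InBase n k y
  row-in-base 1≤b b≤k (row-minus k<c c≤n) = base-minus 1≤b b≤k k<c c≤n
  row-in-base 1≤b b≤k (row-plus k<c c≤n)  = base-plus 1≤b b≤k k<c c≤n
  row-in-base 1≤b b≤k row-short           = base-short 1≤b b≤k

  -- Each row is a chain: e_b - e_{k+1} ≼ … ≼ e_b - e_n ≼ e_b ≼ e_b + e_n ≼ … ≼ e_b + e_{k+1}.
  row-chain : ∀ {b y z} → 1 ≤ b → InRow b y → InRow b z → (z ≼[ n ] y) ⊎ (y ≼[ n ] z)
  row-chain 1≤b (row-minus {c₀} k<c₀ _) (row-minus {c} k<c _) with ℕP.≤-total c c₀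
  ... | inj₁ c≤c₀ = inj₁ (minus≼minus 1≤b 1≤b (pos k<c) (pos k<c₀) ℕP.≤-refl c≤c₀)
  ... | inj₂ c₀≤c = inj₂ (minus≼minus 1≤b 1≤b (pos k<c₀) (pos k<c) ℕP.≤-refl c₀≤c)
  row-chain 1≤b (row-minus k<c₀ _) (row-plus k<c _) = inj₂ (minus≼plus 1≤b (pos k<c₀) (pos k<c))
  row-chain 1≤b (row-minus k<c₀ _) row-short        = inj₂ (minus≼short 1≤b (pos k<c₀))
  row-chain 1≤b (row-plus k<c₀ _) (row-minus k<c _) = inj₁ (minus≼plus 1≤b (pos k<c) (pos k<c₀))
  row-chain 1≤b (row-plus {c₀} k<c₀ _) (row-plus {c} k<c _) with ℕP.≤-total c₀ c
  ... | inj₁ c₀≤c = inj₁ (plus≼plus 1≤b 1≤b (pos k<c₀) (pos k<c) ℕP.≤-refl c₀≤c)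
  ... | inj₂ c≤c₀ = inj₂ (plus≼plus 1≤b 1≤b (pos k<c) (pos k<c₀) ℕP.≤-refl c≤c₀)
  row-chain 1≤b (row-plus k<c₀ _) row-short         = inj₁ (short≼plus 1≤b (pos k<c₀))
  row-chain 1≤b row-short (row-minus k<c _)         = inj₁ (minus≼short 1≤b (pos k<c))
  row-chain 1≤b row-short (row-plus k<c _)          = inj₂ (short≼plus 1≤b (pos k<c))
  row-chain {b} 1≤b row-short row-short             = inj₁ (≼-refl (short b))

  row-summands-le : ∀ (S S' : Subset) b → (∀ {z} → InRow b z → bit (S' z) ≤ bit (S z)) →
                    ∀ c → suc k ≤ c → c < suc k + (n ∸ k) →
                    bit (S' (minus b c)) + bit (S' (plus b c)) ≤ bit (S (minus b c)) + bit (S (plus b c))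
  row-summands-le S S' b le c k<c c< =
    ℕP.+-mono-≤ (le (row-minus k<c (from-row-range c<))) (le (row-plus k<c (from-row-range c<)))

  row-strict : ∀ (S S' : Subset) b → (∀ {z} → InRow b z → bit (S' z) ≤ bit (S z)) →
               ∀ {y} → InRow b y → bit (S' y) < bit (S y) → row S' b < row S b
  row-strict S S' b le (row-minus {c₀} k<c₀ c₀≤n) lt = ℕP.+-mono-<-≤
    (sumRange-strict (suc k) (n ∸ k) _ _ (row-summands-le S S' b le) c₀ k<c₀ (in-row-range c₀≤n)
      (ℕP.+-mono-<-≤ lt (le (row-plus k<c₀ c₀≤n))))
    (le row-short)
  row-strict S S' b le (row-plus {c₀} k<c₀ c₀≤n) lt = ℕP.+-mono-<-≤
    (sumRange-strict (suc k) (n ∸ k) _ _ (row-summands-le S S' b le) c₀ k<c₀ (in-row-range c₀≤n)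
      (ℕP.+-mono-≤-< (le (row-minus k<c₀ c₀≤n)) lt))
    (le row-short)
  row-strict S S' b le row-short lt =
    ℕP.+-mono-≤-< (sumRange-mono (suc k) (n ∸ k) _ _ (row-summands-le S S' b le)) lt

  -- A row of equal size in S and S' has the same roots in both,
  -- as S ∩ row(b) is an ideal of a chain.
  row-determined : ∀ {S S'} → Θ n k S → Θ n k S' → ∀ b → 1 ≤ b → b ≤ k → row S b ≡ row S' b →
                   ∀ {y} → InRow b y → T (S y) → ¬ T (S' y) → ⊥
  row-determined {S} {S'} th th' b 1≤b b≤k same {y} y∈row y∈S y∉S' =
    ℕP.<-irrefl (sym same) (row-strict S S' b dominated y∈row (bit-< y∈S y∉S'))
    where
    dominated : ∀ {z} → InRow b z → bit (S' z) ≤ bit (S z)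
    dominated z∈row = chain-dominance (base-ideal th) (base-ideal th')
      (row-in-base 1≤b b≤k y∈row) (row-in-base 1≤b b≤k z∈row) (row-chain 1≤b y∈row z∈row) y∈S y∉S'

  -- Likewise each column {e_a + e_b : a < b} is a chain, determined by its size.
  col-determined : ∀ {S S'} → Θ n k S → Θ n k S' → ∀ B → suc B ≤ k →
                   col S B (suc B) ≡ col S' B (suc B) →
                   ∀ a → 1 ≤ a → a ≤ B → T (S (plus a (suc B))) → ¬ T (S' (plus a (suc B))) → ⊥
  col-determined {S} {S'} th th' B sB≤k same a 1≤a a≤B y∈S y∉S' =
    ℕP.<-irrefl (sym same) (sumRange-strict 1 B _ _ dominated a 1≤a (s≤s a≤B) (bit-< y∈S y∉S'))
    where
    b = suc B
    in-col : ∀ {a'} → 1 ≤ a' → a' ≤ B → InTop k (plus a' b)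
    in-col 1≤a' a'≤B = top-plus 1≤a' (s≤s a'≤B) sB≤k
    dominated : ∀ a' → 1 ≤ a' → a' < 1 + B → bit (S' (plus a' b)) ≤ bit (S (plus a' b))
    dominated a' 1≤a' (s≤s a'≤B) =
      chain-dominance (top-ideal th) (top-ideal th') (in-col 1≤a a≤B) (in-col 1≤a' a'≤B) comparable y∈S y∉S'
      where
      comparable : (plus a' b ≼[ n ] plus a b) ⊎ (plus a b ≼[ n ] plus a' b)
      comparable with ℕP.≤-total a a'
      ... | inj₁ a≤a' = inj₁ (plus≼plus 1≤a 1≤a' (s≤s z≤n) (s≤s z≤n) a≤a' ℕP.≤-refl)
      ... | inj₂ a'≤a = inj₂ (plus≼plus 1≤a' 1≤a (s≤s z≤n) (s≤s z≤n) a'≤a ℕP.≤-refl)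

  no-root-lost : ∀ {S S'} → Θ n k S → Θ n k S' → (∀ B → B < k → Γ S B ≡ Γ S' B) →
                 ∀ y → T (S y) → ¬ T (S' y) → ⊥
  no-root-lost {S} {S'} th th' sameΓ y y∈S y∉S' = by-region (proj₁ th y y∈S)
    where
    rows : RowsAgreeUpTo S S' k
    rows = rows-agree th th' sameΓ k ℕP.≤-refl
    by-region : InΛ n k y → ⊥
    by-region (inj₁ (base-minus 1≤a a≤k k<c c≤n)) =
      row-determined th th' _ 1≤a a≤k (rows _ 1≤a a≤k) (row-minus k<c c≤n) y∈S y∉S'
    by-region (inj₁ (base-plus 1≤a a≤k k<c c≤n)) =
      row-determined th th' _ 1≤a a≤k (rows _ 1≤a a≤k) (row-plus k<c c≤n) y∈S y∉S'
    by-region (inj₁ (base-short 1≤a a≤k)) =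
      row-determined th th' _ 1≤a a≤k (rows _ 1≤a a≤k) row-short y∈S y∉S'
    by-region (inj₂ (top-plus {a} {suc B} 1≤a (s≤s a≤B) sB≤k)) =
      col-determined th th' B sB≤k same-col a 1≤a a≤B y∈S y∉S'
      where
      same-col : col S B (suc B) ≡ col S' B (suc B)
      same-col = ℕP.+-cancelˡ-≡ (row S (suc B)) _ _
        (trans (sameΓ B sB≤k) (cong (_+ col S' B (suc B)) (sym (rows (suc B) (s≤s z≤n) sB≤k))))

  f-injective : (S S' : Subset) → Θ n k S → Θ n k S' → f n k S ≡ f n k S' → ∀ y → S y ≡ S' y
  f-injective S S' th th' same y = bool-ext
    (no-root-lost th th' (Γ-from-f S S' same) y)
    (no-root-lost th' th (Γ-from-f S' S (sym same)) y)

lemma3p8 : (n k : ℕ) → 1 ≤ k → k < n →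
    ((S : Subset) → Θ n k S → P n k (f n k S))
    × ((S S' : Subset) → Θ n k S → Θ n k S' → f n k S ≡ f n k S' → ∀ r → S r ≡ S' r)
lemma3p8 n k 1≤k k<n = ThetaFacts.f-in-P n k 1≤k k<n , ThetaFacts.f-injective n k 1≤k k<n
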